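{- Let $q$ be a prime power, $\mathrm{PG}(3,q)=\mathrm{AG}(3,q)\cup H_\infty$, and let $U\subset\mathrm{AG}(3,q)$ with $|U|=q^2$, $U$ not contained in a plane. Let $\ell_1,\ell_2$ be two distinct lines of $H_\infty$ not determined by $U$, and let $M=\ell_1\cap\ell_2$. If $f$ and $g$ are two distinct parallel affine lines contained in $U$ whose (common) ideal point lies on $\ell_1$, then their ideal point is $M$.
   Context: A line $\ell\subset H_\infty$ is determined by $U$ if some affine plane whose line at infinity is $\ell$ contains three non-collinear points of $U$. The ideal point of an affine line is its point at infinity. -}

module Defs where

open import Level using (0ℓ)
open import Data.Nat using (ℕ) renaming (_^_ to _^ℕ_)
open import Data.Fin using (Fin)
open import Data.Product using (Σ; ∃; ∃-syntax; _×_; _,_)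
open import Data.List using (List; length)
open import Data.List.Membership.Propositional using (_∈_)
open import Data.List.Relation.Unary.Unique.Propositional using (Unique)
open import Relation.Nullary using (¬_)
open import Relation.Binary.PropositionalEquality using (_≡_)
open import Function.Bundles using (_↔_)
open import Algebra.Structures using (IsCommutativeRing)

-- A finite field (equality is propositional); its order q = size is
-- automatically a prime power, and every prime power arises this way.
record FiniteField : Set₁ where
  infixl 6 _+_
  infixl 7 _*_
  field
    F   : Set
    _+_ : F → F → F
    _*_ : F → F → F
    -_  : F → F
    0#  : F
    1#  : F
    isCommutativeRing : IsCommutativeRing _≡_ _+_ _*_ -_ 0# 1#
    0≢1 : ¬ (0# ≡ 1#)
    inverse : (x : F) → ¬ (x ≡ 0#) → Σ F (λ y → x * y ≡ 1#)
    size : ℕ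
    enum : F ↔ Fin size

module Geometry (K : FiniteField) where
  open FiniteField K public

  q : ℕ
  q = size

  -- Vectors of F³: points of AG(3,q), and (nonzero, up to scalars)
  -- points of H∞ (directions) and lines of H∞ (via normal vectors).
  record V3 : Set where
    constructor ⟨_,_,_⟩
    field x y z : F

  infixl 6 _⊕_ _⊖_
  infixr 7 _·_

  zero3 : V3
  zero3 = ⟨ 0# , 0# , 0# ⟩

  _⊕_ : V3 → V3 → V3
  ⟨ a , b , c ⟩ ⊕ ⟨ a' , b' , c' ⟩ = ⟨ a + a' , b + b' , c + c' ⟩

  _⊖_ : V3 → V3 → V3
  ⟨ a , b , c ⟩ ⊖ ⟨ a' , b' , c' ⟩ = ⟨ a + - a' , b + - b' , c + - c' ⟩

  _·_ : F → V3 → V3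
  t · ⟨ a , b , c ⟩ = ⟨ t * a , t * b , t * c ⟩

  dot : V3 → V3 → F
  dot ⟨ a , b , c ⟩ ⟨ a' , b' , c' ⟩ = a * a' + b * b' + c * c'

  cross : V3 → V3 → V3
  cross ⟨ a , b , c ⟩ ⟨ a' , b' , c' ⟩ =
    ⟨ b * c' + - (c * b') , c * a' + - (a * c') , a * b' + - (b * a') ⟩

  Nonzero : V3 → Set
  Nonzero v = ¬ (v ≡ zero3)

  Proportional : V3 → V3 → Set
  Proportional u v = ∃[ t ] (¬ (t ≡ 0#) × u ≡ t · v)

  Independent : V3 → V3 → Set
  Independent u v = ∀ s t → s · u ⊕ t · v ≡ zero3 → (s ≡ 0#) × (t ≡ 0#)

  -- Points of H∞ = nonzero directions d (up to scalars).
  -- Lines of H∞ = nonzero normal vectors n (up to scalars); the line with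
  -- normal n consists of the directions d with n·d = 0, i.e. it is the line
  -- at infinity of the affine planes {x : n·x = c}.
  OnLine∞ : V3 → V3 → Set
  OnLine∞ d n = dot n d ≡ 0#

  meet∞ : V3 → V3 → V3
  meet∞ n₁ n₂ = cross n₁ n₂

  -- A finite point set of AG(3,q), given as a duplicate-free list.
  PointSet : Set
  PointSet = List V3

  InPlane : PointSet → Set
  InPlane U = ∃[ n ] ∃[ c ] (Nonzero n × (∀ {u} → u ∈ U → dot n u ≡ c))

  -- The line of H∞ with normal n is determined by U: some affine plane
  -- with that line at infinity ({x : n·x = c}) contains three
  -- non-collinear points of U.
  Determined : PointSet → V3 → Set
  Determined U n =
    ∃[ c ] ∃[ u₁ ] ∃[ u₂ ] ∃[ u₃ ]
      (u₁ ∈ U × u₂ ∈ U × u₃ ∈ U ×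
       dot n u₁ ≡ c × dot n u₂ ≡ c × dot n u₃ ≡ c ×
       Independent (u₂ ⊖ u₁) (u₃ ⊖ u₁))

  LineIn : V3 → V3 → PointSet → Set
  LineIn p d U = ∀ t → (p ⊕ (t · d)) ∈ U

  DistinctParallel : V3 → V3 → V3 → Set
  DistinctParallel p p' d = ¬ (∃[ t ] p' ≡ p ⊕ (t · d))

module Submission where

-- Let f = p + ⟨d⟩ and g = p' + ⟨d⟩ be the two parallel lines
-- of U, with normals n₁, n₂ of the undetermined lines ℓ₁, ℓ₂ of H∞.  Since
-- d ∈ ℓ₁, it suffices to show d ∈ ℓ₂: a point on both lines of H∞ is their
-- intersection M = n₁ × n₂.  Suppose d ∉ ℓ₂, i.e. n₂·d ≠ 0.  Then every
-- affine plane n₂·x = c meets f and g, in points a and b.  Let σ be the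
-- plane spanned by f and g (normal d × (p' − p)).  If some u ∈ U were off σ,
-- then a, b, u would be three non-collinear points of U in the plane
-- n₂·x = n₂·u, so ℓ₂ would be determined by U.  Hence U ⊆ σ, contradicting
-- that U is not contained in a plane.

open import Level using (0ℓ)
open import Data.Empty using (⊥-elim)
open import Data.Fin.Properties as Fin using ()
open import Data.List using (length)
open import Data.List.Membership.Propositional using (_∈_)
open import Data.List.Relation.Unary.Unique.Propositional using (Unique)
open import Data.Maybe.Base using (Maybe; just; nothing)
open import Data.Nat.Base as ℕ using (zero; suc; _^_)
import Data.Nat.Properties as ℕₚ
open import Data.Integer.Base as ℤ using (ℤ; +_; -[1+_]; sign; ∣_∣; _◃_)
import Data.Integer.Properties as ℤₚ
open import Data.Product using (Σ; _,_; proj₁; proj₂)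
open import Data.Sign.Base as Sign using (Sign)
open import Algebra.Bundles using (CommutativeRing)
open import Algebra.Solver.Ring.AlmostCommutativeRing
  using (_-Raw-AlmostCommutative⟶_; fromCommutativeRing)
open import Function.Properties.Inverse using (↔⇒↣)
open import Relation.Binary.PropositionalEquality as ≡ using (_≡_; _≢_)
open import Relation.Nullary using (¬_; Dec; yes; no)
open import Relation.Nullary.Decidable using (via-injection)

open import Defs

-- Every commutative ring R receives the canonical map ℤ → R, which is a
-- ring morphism.  This instantiates the standard ring solver over R with
-- integer coefficients, whose equality is decidable, so that polynomial
-- identities over an abstract R (such as a finite field) normalise.
module IntegerCoefficientSolver {c ℓ} (R : CommutativeRing c ℓ) where
  open CommutativeRing R
  open import Algebra.Properties.Ring ring using (-0#≈0#; -‿involutive; -1*x≈-x; -‿+-comm)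
  open import Algebra.Properties.Semiring.Mult semiring using (_×_; ×-homo-+; ×1-homo-*)
  open import Algebra.Properties.CommutativeSemigroup *-commutativeSemigroup using (interchange)
  open import Relation.Binary.Reasoning.Setoid setoid

  ⟦_⟧ˢ : Sign → Carrier
  ⟦ Sign.+ ⟧ˢ = 1#
  ⟦ Sign.- ⟧ˢ = - 1#

  ⟦_⟧ : ℤ → Carrier
  ⟦ i ⟧ = ⟦ sign i ⟧ˢ * (∣ i ∣ × 1#)

  ⟦+⟧ : ∀ n → ⟦ + n ⟧ ≈ n × 1#
  ⟦+⟧ n = *-identityˡ _

  ⟦-⟧ : ∀ n → ⟦ -[1+ n ] ⟧ ≈ - (suc n × 1#)
  ⟦-⟧ n = -1*x≈-x _

  sign-homo : ∀ s t → ⟦ s Sign.* t ⟧ˢ ≈ ⟦ s ⟧ˢ * ⟦ t ⟧ˢ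
  sign-homo Sign.+ t      = sym (*-identityˡ _)
  sign-homo Sign.- Sign.+ = sym (*-identityʳ _)
  sign-homo Sign.- Sign.- = sym (trans (-1*x≈-x (- 1#)) (-‿involutive 1#))

  ◃-homo : ∀ s n → ⟦ s ◃ n ⟧ ≈ ⟦ s ⟧ˢ * (n × 1#)
  ◃-homo s      zero    = trans (zeroʳ _) (sym (zeroʳ _))
  ◃-homo Sign.+ (suc n) = refl
  ◃-homo Sign.- (suc n) = refl

  *-homo : ∀ i j → ⟦ i ℤ.* j ⟧ ≈ ⟦ i ⟧ * ⟦ j ⟧
  *-homo i j = begin
    ⟦ sign i Sign.* sign j ◃ ∣ i ∣ ℕ.* ∣ j ∣ ⟧
      ≈⟨ ◃-homo (sign i Sign.* sign j) (∣ i ∣ ℕ.* ∣ j ∣) ⟩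
    ⟦ sign i Sign.* sign j ⟧ˢ * ((∣ i ∣ ℕ.* ∣ j ∣) × 1#)
      ≈⟨ *-cong (sign-homo (sign i) (sign j)) (×1-homo-* ∣ i ∣ ∣ j ∣) ⟩
    (⟦ sign i ⟧ˢ * ⟦ sign j ⟧ˢ) * ((∣ i ∣ × 1#) * (∣ j ∣ × 1#))
      ≈⟨ interchange _ _ _ _ ⟩
    ⟦ i ⟧ * ⟦ j ⟧ ∎

  cancel-1 : ∀ a b → (1# + a) - (1# + b) ≈ a - b
  cancel-1 a b = begin
    (1# + a) + - (1# + b)    ≈⟨ +-congˡ (-‿+-comm 1# b) ⟨
    (1# + a) + (- 1# + - b)  ≈⟨ +-congʳ (+-comm 1# a) ⟩
    (a + 1#) + (- 1# + - b)  ≈⟨ +-assoc a 1# _ ⟩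
    a + (1# + (- 1# + - b))  ≈⟨ +-congˡ (+-assoc 1# (- 1#) (- b)) ⟨
    a + ((1# - 1#) + - b)    ≈⟨ +-congˡ (+-congʳ (-‿inverseʳ 1#)) ⟩
    a + (0# + - b)           ≈⟨ +-congˡ (+-identityˡ _) ⟩
    a - b                    ∎

  -- additivity is reduced to the natural-number difference m ⊖ n
  ⊖-homo : ∀ m n → ⟦ m ℤ.⊖ n ⟧ ≈ m × 1# - n × 1#
  ⊖-homo zero    zero    = trans (zeroʳ _) (sym (trans (+-identityˡ _) -0#≈0#))
  ⊖-homo zero    (suc n) = trans (⟦-⟧ n) (sym (+-identityˡ _))
  ⊖-homo (suc m) zero    = trans (⟦+⟧ (suc m)) (sym (trans (+-congˡ -0#≈0#) (+-identityʳ _)))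
  ⊖-homo (suc m) (suc n) = begin
    ⟦ suc m ℤ.⊖ suc n ⟧      ≡⟨ ≡.cong ⟦_⟧ (ℤₚ.[1+m]⊖[1+n]≡m⊖n m n) ⟩
    ⟦ m ℤ.⊖ n ⟧              ≈⟨ ⊖-homo m n ⟩
    m × 1# - n × 1#          ≈⟨ cancel-1 _ _ ⟨
    suc m × 1# - suc n × 1#  ∎

  +-homo : ∀ i j → ⟦ i ℤ.+ j ⟧ ≈ ⟦ i ⟧ + ⟦ j ⟧
  +-homo -[1+ m ] -[1+ n ] = begin
    ⟦ -[1+ suc (m ℕ.+ n) ] ⟧         ≈⟨ ⟦-⟧ (suc (m ℕ.+ n)) ⟩
    - (suc (suc (m ℕ.+ n)) × 1#)     ≡⟨ ≡.cong (λ k → - (suc k × 1#)) (≡.sym (ℕₚ.+-suc m n)) ⟩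
    - ((suc m ℕ.+ suc n) × 1#)       ≈⟨ -‿cong (×-homo-+ 1# (suc m) (suc n)) ⟩
    - (suc m × 1# + suc n × 1#)      ≈⟨ -‿+-comm _ _ ⟨
    - (suc m × 1#) + - (suc n × 1#)  ≈⟨ +-cong (⟦-⟧ m) (⟦-⟧ n) ⟨
    ⟦ -[1+ m ] ⟧ + ⟦ -[1+ n ] ⟧      ∎
  +-homo -[1+ m ] (+ n) =
    trans (⊖-homo n (suc m)) (trans (+-comm _ _) (sym (+-cong (⟦-⟧ m) (⟦+⟧ n))))
  +-homo (+ m) -[1+ n ] = trans (⊖-homo m (suc n)) (sym (+-cong (⟦+⟧ m) (⟦-⟧ n)))
  +-homo (+ m) (+ n) =
    trans (⟦+⟧ (m ℕ.+ n)) (trans (×-homo-+ 1# m n) (sym (+-cong (⟦+⟧ m) (⟦+⟧ n))))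

  neg-homo : ∀ i → ⟦ ℤ.- i ⟧ ≈ - ⟦ i ⟧
  neg-homo (+ zero)  = trans (zeroʳ _) (sym (trans (-‿cong (zeroʳ _)) -0#≈0#))
  neg-homo (+ suc n) = trans (⟦-⟧ n) (-‿cong (sym (⟦+⟧ (suc n))))
  neg-homo -[1+ n ]  =
    trans (⟦+⟧ (suc n)) (trans (sym (-‿involutive _)) (-‿cong (sym (⟦-⟧ n))))

  ℤ-morphism : ℤ.+-*-rawRing -Raw-AlmostCommutative⟶ fromCommutativeRing R
  ℤ-morphism = record
    { ⟦_⟧ = ⟦_⟧ ; +-homo = +-homo ; *-homo = *-homo ; -‿homo = neg-homo
    ; 0-homo = zeroʳ _ ; 1-homo = trans (*-identityˡ _) (+-identityʳ _) }

  ℤ-coefficient≟ : ∀ i j → Maybe (⟦ i ⟧ ≈ ⟦ j ⟧)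
  ℤ-coefficient≟ i j with i ℤₚ.≟ j
  ... | yes ≡.refl = just refl
  ... | no _       = nothing

  open import Algebra.Solver.Ring ℤ.+-*-rawRing (fromCommutativeRing R) ℤ-morphism ℤ-coefficient≟ public
    using (Polynomial; solve; _:=_; _:+_; _:*_; :-_)

module AffineSpace (K : FiniteField) where
  open Geometry K
  open ≡ using (refl; sym; trans; cong; cong₂)
  open ≡.≡-Reasoning

  commutativeRing : CommutativeRing 0ℓ 0ℓ
  commutativeRing = record { isCommutativeRing = isCommutativeRing }

  open CommutativeRing commutativeRing
    using (_-_; +-identityˡ; +-identityʳ; *-comm; *-identityˡ; zeroˡ; zeroʳ; -‿inverseʳ; +-group)
  open import Algebra.Properties.Group +-group using (x∙y⁻¹≈ε⇒x≈y)
  open IntegerCoefficientSolver commutativeRing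

  _≟F_ : (a b : F) → Dec (a ≡ b)
  _≟F_ = via-injection (↔⇒↣ enum) Fin._≟_

  cancel-nonzero : ∀ {x y} → x ≢ 0# → x * y ≡ 0# → y ≡ 0#
  cancel-nonzero {x} {y} x≢0 xy≡0 with inverse x x≢0
  ... | x⁻¹ , xx⁻¹≡1 = begin
    y                ≡⟨ sym (*-identityˡ y) ⟩
    1# * y           ≡⟨ cong (_* y) (sym xx⁻¹≡1) ⟩
    (x * x⁻¹) * y    ≡⟨ solve 3 (λ x x⁻¹ y → (x :* x⁻¹) :* y := x⁻¹ :* (x :* y)) refl x x⁻¹ y ⟩
    x⁻¹ * (x * y)    ≡⟨ cong (x⁻¹ *_) xy≡0 ⟩
    x⁻¹ * 0#         ≡⟨ zeroʳ x⁻¹ ⟩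
    0#               ∎

  inverse-nonzero : ∀ {x y} → x * y ≡ 1# → y ≢ 0#
  inverse-nonzero {x} xy≡1 refl = 0≢1 (trans (sym (zeroʳ x)) xy≡1)

  difference-zero : ∀ {a b} → a - b ≡ 0# → a ≡ b
  difference-zero = x∙y⁻¹≈ε⇒x≈y _ _

  V3-≡ : ∀ {a b c a' b' c'} → a ≡ a' → b ≡ b' → c ≡ c' → ⟨ a , b , c ⟩ ≡ ⟨ a' , b' , c' ⟩
  V3-≡ refl refl refl = refl

  scale-by-zero : ∀ v → 0# · v ≡ zero3
  scale-by-zero ⟨ a , b , c ⟩ = V3-≡ (zeroˡ a) (zeroˡ b) (zeroˡ c)

  ⊕-identityʳ : ∀ v → v ⊕ zero3 ≡ v
  ⊕-identityʳ ⟨ a , b , c ⟩ = V3-≡ (+-identityʳ a) (+-identityʳ b) (+-identityʳ c)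

  dot-zeroʳ : ∀ n → dot n zero3 ≡ 0#
  dot-zeroʳ ⟨ a , b , c ⟩ = begin
    a * 0# + b * 0# + c * 0#  ≡⟨ cong₂ _+_ (cong₂ _+_ (zeroʳ a) (zeroʳ b)) (zeroʳ c) ⟩
    0# + 0# + 0#              ≡⟨ cong (_+ 0#) (+-identityˡ 0#) ⟩
    0# + 0#                   ≡⟨ +-identityˡ 0# ⟩
    0#                        ∎

  scale-cancel : ∀ s v → Nonzero v → s · v ≡ zero3 → s ≡ 0#
  scale-cancel s ⟨ a , b , c ⟩ v≢0 sv≡0 with s ≟F 0#
  ... | yes s≡0 = s≡0
  ... | no  s≢0 = ⊥-elim (v≢0 (V3-≡ (cancel-nonzero s≢0 (cong V3.x sv≡0))
                                    (cancel-nonzero s≢0 (cong V3.y sv≡0))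
                                    (cancel-nonzero s≢0 (cong V3.z sv≡0))))

  -- Syntactic vectors of polynomials, mirroring the operations of F³ so that
  -- vector identities can be handed to the solver componentwise.
  record V3ᴾ (m : ℕ.ℕ) : Set where
    constructor ⟪_,_,_⟫
    field xᴾ yᴾ zᴾ : Polynomial m

  dotᴾ : ∀ {m} → V3ᴾ m → V3ᴾ m → Polynomial m
  dotᴾ ⟪ a , b , c ⟫ ⟪ a' , b' , c' ⟫ = a :* a' :+ b :* b' :+ c :* c'

  crossᴾ : ∀ {m} → V3ᴾ m → V3ᴾ m → V3ᴾ m
  crossᴾ ⟪ a , b , c ⟫ ⟪ a' , b' , c' ⟫ =
    ⟪ b :* c' :+ :- (c :* b') , c :* a' :+ :- (a :* c') , a :* b' :+ :- (b :* a') ⟫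

  _⊕ᴾ_ : ∀ {m} → V3ᴾ m → V3ᴾ m → V3ᴾ m
  ⟪ a , b , c ⟫ ⊕ᴾ ⟪ a' , b' , c' ⟫ = ⟪ a :+ a' , b :+ b' , c :+ c' ⟫

  _⊖ᴾ_ : ∀ {m} → V3ᴾ m → V3ᴾ m → V3ᴾ m
  ⟪ a , b , c ⟫ ⊖ᴾ ⟪ a' , b' , c' ⟫ = ⟪ a :+ :- a' , b :+ :- b' , c :+ :- c' ⟫

  _·ᴾ_ : ∀ {m} → Polynomial m → V3ᴾ m → V3ᴾ m
  t ·ᴾ ⟪ a , b , c ⟫ = ⟪ t :* a , t :* b , t :* c ⟫

  dot-along-line : ∀ n p d t → dot n (p ⊕ t · d) ≡ dot n p + t * dot n d
  dot-along-line ⟨ n1 , n2 , n3 ⟩ ⟨ p1 , p2 , p3 ⟩ ⟨ d1 , d2 , d3 ⟩ t =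
    solve 10 (λ n1 n2 n3 p1 p2 p3 d1 d2 d3 t →
      let n = ⟪ n1 , n2 , n3 ⟫ ; p = ⟪ p1 , p2 , p3 ⟫ ; d = ⟪ d1 , d2 , d3 ⟫ in
      dotᴾ n (p ⊕ᴾ (t ·ᴾ d)) := dotᴾ n p :+ t :* dotᴾ n d)
      refl n1 n2 n3 p1 p2 p3 d1 d2 d3 t

  dot-combination : ∀ n a b u s t →
    dot n (s · (b ⊖ a) ⊕ t · (u ⊖ a)) ≡ s * (dot n b - dot n a) + t * (dot n u - dot n a)
  dot-combination ⟨ n1 , n2 , n3 ⟩ ⟨ a1 , a2 , a3 ⟩ ⟨ b1 , b2 , b3 ⟩ ⟨ u1 , u2 , u3 ⟩ s t =
    solve 14 (λ n1 n2 n3 a1 a2 a3 b1 b2 b3 u1 u2 u3 s t →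
      let n = ⟪ n1 , n2 , n3 ⟫ ; a = ⟪ a1 , a2 , a3 ⟫ ; b = ⟪ b1 , b2 , b3 ⟫ ; u = ⟪ u1 , u2 , u3 ⟫ in
      dotᴾ n ((s ·ᴾ (b ⊖ᴾ a)) ⊕ᴾ (t ·ᴾ (u ⊖ᴾ a)))
        := s :* (dotᴾ n b :+ :- dotᴾ n a) :+ t :* (dotᴾ n u :+ :- dotᴾ n a))
      refl n1 n2 n3 a1 a2 a3 b1 b2 b3 u1 u2 u3 s t

  triple-product : ∀ a b d → cross (cross a b) d ≡ dot a d · b ⊖ dot b d · a
  triple-product ⟨ a1 , a2 , a3 ⟩ ⟨ b1 , b2 , b3 ⟩ ⟨ d1 , d2 , d3 ⟩ = V3-≡
    (solve 9 (λ a1 a2 a3 b1 b2 b3 d1 d2 d3 → let open Sides a1 a2 a3 b1 b2 b3 d1 d2 d3 in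
       V3ᴾ.xᴾ lhs := V3ᴾ.xᴾ rhs) refl a1 a2 a3 b1 b2 b3 d1 d2 d3)
    (solve 9 (λ a1 a2 a3 b1 b2 b3 d1 d2 d3 → let open Sides a1 a2 a3 b1 b2 b3 d1 d2 d3 in
       V3ᴾ.yᴾ lhs := V3ᴾ.yᴾ rhs) refl a1 a2 a3 b1 b2 b3 d1 d2 d3)
    (solve 9 (λ a1 a2 a3 b1 b2 b3 d1 d2 d3 → let open Sides a1 a2 a3 b1 b2 b3 d1 d2 d3 in
       V3ᴾ.zᴾ lhs := V3ᴾ.zᴾ rhs) refl a1 a2 a3 b1 b2 b3 d1 d2 d3)
    where
    module Sides (a1 a2 a3 b1 b2 b3 d1 d2 d3 : Polynomial 9) where
      a b d lhs rhs : V3ᴾ 9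
      a = ⟪ a1 , a2 , a3 ⟫
      b = ⟪ b1 , b2 , b3 ⟫
      d = ⟪ d1 , d2 , d3 ⟫
      lhs = crossᴾ (crossᴾ a b) d
      rhs = (dotᴾ a d ·ᴾ b) ⊖ᴾ (dotᴾ b d ·ᴾ a)

  cross-normal-along-line : ∀ d w x t → dot (cross d w) (x ⊕ t · d) ≡ dot (cross d w) x
  cross-normal-along-line ⟨ d1 , d2 , d3 ⟩ ⟨ w1 , w2 , w3 ⟩ ⟨ x1 , x2 , x3 ⟩ t =
    solve 10 (λ d1 d2 d3 w1 w2 w3 x1 x2 x3 t →
      let d = ⟪ d1 , d2 , d3 ⟫ ; w = ⟪ w1 , w2 , w3 ⟫ ; x = ⟪ x1 , x2 , x3 ⟫ in
      dotᴾ (crossᴾ d w) (x ⊕ᴾ (t ·ᴾ d)) := dotᴾ (crossᴾ d w) x)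
      refl d1 d2 d3 w1 w2 w3 x1 x2 x3 t

  cross-normal-difference : ∀ d x y → dot (cross d (y ⊖ x)) y ≡ dot (cross d (y ⊖ x)) x
  cross-normal-difference ⟨ d1 , d2 , d3 ⟩ ⟨ x1 , x2 , x3 ⟩ ⟨ y1 , y2 , y3 ⟩ =
    solve 9 (λ d1 d2 d3 x1 x2 x3 y1 y2 y3 →
      let d = ⟪ d1 , d2 , d3 ⟫ ; x = ⟪ x1 , x2 , x3 ⟫ ; y = ⟪ y1 , y2 , y3 ⟫ in
      dotᴾ (crossᴾ d (y ⊖ᴾ x)) y := dotᴾ (crossᴾ d (y ⊖ᴾ x)) x)
      refl d1 d2 d3 x1 x2 x3 y1 y2 y3

  translate-by-difference : ∀ x y → y ≡ x ⊕ (y ⊖ x)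
  translate-by-difference ⟨ x1 , x2 , x3 ⟩ ⟨ y1 , y2 , y3 ⟩ =
    V3-≡ (shift x1 y1) (shift x2 y2) (shift x3 y3)
    where
    shift : ∀ a b → b ≡ a + (b - a)
    shift = solve 2 (λ a b → b := a :+ (b :+ :- a)) refl

  move-along-line : ∀ {x y e} s t → y + s * e ≡ x + t * e → y ≡ x + (t - s) * e
  move-along-line {x} {y} {e} s t eq = begin
    y                          ≡⟨ solve 3 (λ y s e → y := (y :+ s :* e) :+ :- (s :* e)) refl y s e ⟩
    (y + s * e) - s * e        ≡⟨ cong (_- s * e) eq ⟩
    (x + t * e) - s * e        ≡⟨ solve 4 (λ x t s e → (x :+ t :* e) :+ :- (s :* e) := x :+ (t :+ :- s) :* e) refl x t s e ⟩
    x + (t - s) * e            ∎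

  ratio : ∀ {ak bk aj bj i} → ak * i ≡ 1# → ak * bj ≡ aj * bk → bj ≡ (i * bk) * aj
  ratio {ak} {bk} {aj} {bj} {i} ak·i≡1 cross≡ = sym (begin
    (i * bk) * aj   ≡⟨ solve 3 (λ i bk aj → (i :* bk) :* aj := i :* (aj :* bk)) refl i bk aj ⟩
    i * (aj * bk)   ≡⟨ cong (i *_) (sym cross≡) ⟩
    i * (ak * bj)   ≡⟨ solve 3 (λ i ak bj → i :* (ak :* bj) := (ak :* i) :* bj) refl i ak bj ⟩
    (ak * i) * bj   ≡⟨ cong (_* bj) ak·i≡1 ⟩
    1# * bj         ≡⟨ *-identityˡ bj ⟩
    bj              ∎)

  cross-zero⇒multiple : ∀ a b → Nonzero a → cross a b ≡ zero3 → Σ F λ t → b ≡ t · a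
  cross-zero⇒multiple ⟨ a1 , a2 , a3 ⟩ ⟨ b1 , b2 , b3 ⟩ a≢0 a×b≡0 =
    by-pivot (a1 ≟F 0#) (a2 ≟F 0#) (a3 ≟F 0#)
    where
    c₁ : a2 * b3 ≡ a3 * b2
    c₁ = difference-zero (cong V3.x a×b≡0)
    c₂ : a3 * b1 ≡ a1 * b3
    c₂ = difference-zero (cong V3.y a×b≡0)
    c₃ : a1 * b2 ≡ a2 * b1
    c₃ = difference-zero (cong V3.z a×b≡0)

    by-pivot : Dec (a1 ≡ 0#) → Dec (a2 ≡ 0#) → Dec (a3 ≡ 0#) →
               Σ F λ t → ⟨ b1 , b2 , b3 ⟩ ≡ t · ⟨ a1 , a2 , a3 ⟩
    by-pivot (no a1≢0) _ _ = let i , a1i≡1 = inverse a1 a1≢0 in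
      i * b1 , V3-≡ (ratio a1i≡1 refl) (ratio a1i≡1 c₃) (ratio a1i≡1 (sym c₂))
    by-pivot (yes _) (no a2≢0) _ = let i , a2i≡1 = inverse a2 a2≢0 in
      i * b2 , V3-≡ (ratio a2i≡1 (sym c₃)) (ratio a2i≡1 refl) (ratio a2i≡1 c₁)
    by-pivot (yes _) (yes _) (no a3≢0) = let i , a3i≡1 = inverse a3 a3≢0 in
      i * b3 , V3-≡ (ratio a3i≡1 c₂) (ratio a3i≡1 (sym c₁)) (ratio a3i≡1 refl)
    by-pivot (yes a1≡0) (yes a2≡0) (yes a3≡0) = ⊥-elim (a≢0 (V3-≡ a1≡0 a2≡0 a3≡0))

  multiple⇒Proportional : ∀ {t} a b → Nonzero b → b ≡ t · a → Proportional b a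
  multiple⇒Proportional {t} a b b≢0 b≡ta =
    t , (λ t≡0 → b≢0 (trans b≡ta (trans (cong (_· a) t≡0) (scale-by-zero a)))) , b≡ta

  Proportional-sym : ∀ a b → Proportional a b → Proportional b a
  Proportional-sym ⟨ a1 , a2 , a3 ⟩ ⟨ b1 , b2 , b3 ⟩ (t , t≢0 , a≡tb) =
    let t⁻¹ , tt⁻¹≡1 = inverse t t≢0
        unscale : ∀ {a b} → a ≡ t * b → b ≡ t⁻¹ * a
        unscale {a} {b} a≡tb = sym (begin
          t⁻¹ * a          ≡⟨ cong (t⁻¹ *_) a≡tb ⟩
          t⁻¹ * (t * b)    ≡⟨ solve 3 (λ t⁻¹ t b → t⁻¹ :* (t :* b) := (t :* t⁻¹) :* b) refl t⁻¹ t b ⟩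
          (t * t⁻¹) * b    ≡⟨ cong (_* b) tt⁻¹≡1 ⟩
          1# * b           ≡⟨ *-identityˡ b ⟩
          b                ∎)
    in t⁻¹ , inverse-nonzero tt⁻¹≡1 ,
       V3-≡ (unscale (cong V3.x a≡tb)) (unscale (cong V3.y a≡tb)) (unscale (cong V3.z a≡tb))

  cross-zero⇒Proportional : ∀ a b → Nonzero a → Nonzero b → cross a b ≡ zero3 → Proportional b a
  cross-zero⇒Proportional a b a≢0 b≢0 a×b≡0 =
    let t , b≡ta = cross-zero⇒multiple a b a≢0 a×b≡0 in multiple⇒Proportional a b b≢0 b≡ta

  meet∞-nonzero : ∀ n₁ n₂ → Nonzero n₁ → Nonzero n₂ → ¬ Proportional n₁ n₂ → Nonzero (meet∞ n₁ n₂)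
  meet∞-nonzero n₁ n₂ n₁≢0 n₂≢0 ℓ₁≢ℓ₂ n₁×n₂≡0 =
    ℓ₁≢ℓ₂ (Proportional-sym n₂ n₁ (cross-zero⇒Proportional n₁ n₂ n₁≢0 n₂≢0 n₁×n₂≡0))

  common-point⇒meet∞ : ∀ n₁ n₂ d → Nonzero n₁ → Nonzero n₂ → ¬ Proportional n₁ n₂ → Nonzero d →
    OnLine∞ d n₁ → OnLine∞ d n₂ → Proportional d (meet∞ n₁ n₂)
  common-point⇒meet∞ n₁ n₂ d n₁≢0 n₂≢0 ℓ₁≢ℓ₂ d≢0 d∈ℓ₁ d∈ℓ₂ =
    cross-zero⇒Proportional (meet∞ n₁ n₂) d (meet∞-nonzero n₁ n₂ n₁≢0 n₂≢0 ℓ₁≢ℓ₂) d≢0 (begin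
      cross (cross n₁ n₂) d            ≡⟨ triple-product n₁ n₂ d ⟩
      dot n₁ d · n₂ ⊖ dot n₂ d · n₁    ≡⟨ cong₂ (λ s t → s · n₂ ⊖ t · n₁) d∈ℓ₁ d∈ℓ₂ ⟩
      0# · n₂ ⊖ 0# · n₁                ≡⟨ cong₂ _⊖_ (scale-by-zero n₂) (scale-by-zero n₁) ⟩
      zero3 ⊖ zero3                    ≡⟨ V3-≡ (-‿inverseʳ 0#) (-‿inverseʳ 0#) (-‿inverseʳ 0#) ⟩
      zero3                            ∎)

  line-meets-plane : ∀ n p d → ¬ OnLine∞ d n → ∀ c → Σ F λ t → dot n (p ⊕ t · d) ≡ c
  line-meets-plane n p d d∉ℓ c =
    let i , nd·i≡1 = inverse (dot n d) d∉ℓ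
        P = dot n p ; e = dot n d
    in i * (c - P) , (begin
      dot n (p ⊕ (i * (c - P)) · d)  ≡⟨ dot-along-line n p d (i * (c - P)) ⟩
      P + (i * (c - P)) * e          ≡⟨ solve 4 (λ P c e i → P :+ (i :* (c :+ :- P)) :* e := P :+ (e :* i) :* (c :+ :- P)) refl P c e i ⟩
      P + (e * i) * (c - P)          ≡⟨ cong (λ z → P + z * (c - P)) nd·i≡1 ⟩
      P + 1# * (c - P)               ≡⟨ cong (λ z → P + z) (*-identityˡ (c - P)) ⟩
      P + (c - P)                    ≡⟨ solve 2 (λ P c → P :+ (c :+ :- P) := c) refl P c ⟩
      c                              ∎)

  distinct-parallels⇒distinct-points : ∀ p p' d → DistinctParallel p p' d →
    ∀ s t → Nonzero ((p' ⊕ t · d) ⊖ (p ⊕ s · d))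
  distinct-parallels⇒distinct-points ⟨ _ , _ , _ ⟩ ⟨ _ , _ , _ ⟩ ⟨ _ , _ , _ ⟩ f≢g s t b-a≡0 =
    f≢g (s - t , V3-≡ (on-f (cong V3.x b-a≡0)) (on-f (cong V3.y b-a≡0)) (on-f (cong V3.z b-a≡0)))
    where
    on-f : ∀ {y x e} → (y + t * e) - (x + s * e) ≡ 0# → y ≡ x + (s - t) * e
    on-f eq = move-along-line t s (difference-zero eq)

  span-normal-nonzero : ∀ p p' d → Nonzero d → DistinctParallel p p' d → Nonzero (cross d (p' ⊖ p))
  span-normal-nonzero p p' d d≢0 f≢g d×w≡0 =
    let t , w≡td = cross-zero⇒multiple d (p' ⊖ p) d≢0 d×w≡0
    in f≢g (t , trans (translate-by-difference p p') (cong (p ⊕_) w≡td))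

  off-plane⇒Independent : ∀ m c a b u → dot m a ≡ c → dot m b ≡ c → dot m u ≢ c →
    Nonzero (b ⊖ a) → Independent (b ⊖ a) (u ⊖ a)
  off-plane⇒Independent m c a b u a∈σ b∈σ u∉σ b≢a s t comb≡0 = s≡0 , t≡0
    where
    -- applying m· to the combination leaves only the u-term
    t-term≡0 : t * (dot m u - c) ≡ 0#
    t-term≡0 = begin
      t * (dot m u - c)
        ≡⟨ solve 4 (λ s t X c → t :* (X :+ :- c) := s :* (c :+ :- c) :+ t :* (X :+ :- c)) refl s t (dot m u) c ⟩
      s * (c - c) + t * (dot m u - c)
        ≡⟨ cong₂ (λ x y → s * (y - x) + t * (dot m u - x)) (sym a∈σ) (sym b∈σ) ⟩
      s * (dot m b - dot m a) + t * (dot m u - dot m a)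
        ≡⟨ sym (dot-combination m a b u s t) ⟩
      dot m (s · (b ⊖ a) ⊕ t · (u ⊖ a))
        ≡⟨ cong (dot m) comb≡0 ⟩
      dot m zero3
        ≡⟨ dot-zeroʳ m ⟩
      0# ∎

    t≡0 : t ≡ 0#
    t≡0 = cancel-nonzero (λ gap≡0 → u∉σ (difference-zero gap≡0)) (trans (*-comm _ t) t-term≡0)

    s≡0 : s ≡ 0#
    s≡0 = scale-cancel s (b ⊖ a) b≢a (begin
      s · (b ⊖ a)                    ≡⟨ sym (⊕-identityʳ (s · (b ⊖ a))) ⟩
      s · (b ⊖ a) ⊕ zero3            ≡⟨ cong (s · (b ⊖ a) ⊕_) (sym (scale-by-zero (u ⊖ a))) ⟩
      s · (b ⊖ a) ⊕ 0# · (u ⊖ a)     ≡⟨ cong (λ r → s · (b ⊖ a) ⊕ r · (u ⊖ a)) (sym t≡0) ⟩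
      s · (b ⊖ a) ⊕ t · (u ⊖ a)      ≡⟨ comb≡0 ⟩
      zero3                          ∎)

  -- If U contains two distinct parallel lines whose ideal point
  -- d is off a line ℓ (normal n) of H∞ not determined by U, then U lies in
  -- the plane σ spanned by the two lines: a point u ∈ U off σ, together with
  -- the points where the plane n·x = n·u meets the two lines, would be three
  -- non-collinear points of U determining ℓ.
  parallels-span-U : (U : PointSet) (n : V3) → ¬ Determined U n →
    (p p' d : V3) → Nonzero d → LineIn p d U → LineIn p' d U → DistinctParallel p p' d →
    ¬ OnLine∞ d n → InPlane U
  parallels-span-U U n ℓ-undetermined p p' d d≢0 f⊆U g⊆U f≢g d∉ℓ =
    σ , dot σ p , span-normal-nonzero p p' d d≢0 f≢g , U⊆σ
    where
    σ : V3
    σ = cross d (p' ⊖ p)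

    U⊆σ : ∀ {u} → u ∈ U → dot σ u ≡ dot σ p
    U⊆σ {u} u∈U with dot σ u ≟F dot σ p
    ... | yes u∈σ = u∈σ
    ... | no  u∉σ = ⊥-elim (ℓ-undetermined
          (dot n u , a , b , u , f⊆U s , g⊆U t , u∈U , a∈plane , b∈plane , refl , a-b-u-independent))
      where
      s t : F
      s = proj₁ (line-meets-plane n p d d∉ℓ (dot n u))
      t = proj₁ (line-meets-plane n p' d d∉ℓ (dot n u))
      a b : V3
      a = p ⊕ s · d
      b = p' ⊕ t · d
      a∈plane : dot n a ≡ dot n u
      a∈plane = proj₂ (line-meets-plane n p d d∉ℓ (dot n u))
      b∈plane : dot n b ≡ dot n u
      b∈plane = proj₂ (line-meets-plane n p' d d∉ℓ (dot n u))
      a∈σ : dot σ a ≡ dot σ p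
      a∈σ = cross-normal-along-line d (p' ⊖ p) p s
      b∈σ : dot σ b ≡ dot σ p
      b∈σ = trans (cross-normal-along-line d (p' ⊖ p) p' t) (cross-normal-difference d p p')
      a-b-u-independent : Independent (b ⊖ a) (u ⊖ a)
      a-b-u-independent = off-plane⇒Independent σ (dot σ p) a b u a∈σ b∈σ u∉σ
        (distinct-parallels⇒distinct-points p p' d f≢g s t)

  parallels-on-undetermined-line : (U : PointSet) → ¬ InPlane U → (n : V3) → ¬ Determined U n →
    (p p' d : V3) → Nonzero d → LineIn p d U → LineIn p' d U → DistinctParallel p p' d →
    OnLine∞ d n
  parallels-on-undetermined-line U not-planar n ℓ-undetermined p p' d d≢0 f⊆U g⊆U f≢g
    with dot n d ≟F 0#
  ... | yes d∈ℓ = d∈ℓ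
  ... | no  d∉ℓ = ⊥-elim (not-planar (parallels-span-U U n ℓ-undetermined p p' d d≢0 f⊆U g⊆U f≢g d∉ℓ))

lemma3 : (K : FiniteField) → let open Geometry K in
    (U : PointSet) → Unique U → length U ≡ q ^ 2 → ¬ InPlane U →
    (n₁ n₂ : V3) → Nonzero n₁ → Nonzero n₂ → ¬ Proportional n₁ n₂ →
    ¬ Determined U n₁ → ¬ Determined U n₂ →
    (p p' d : V3) → Nonzero d →
    LineIn p d U → LineIn p' d U → DistinctParallel p p' d →
    OnLine∞ d n₁ →
    Proportional d (meet∞ n₁ n₂)
lemma3 K U _ _ not-planar n₁ n₂ n₁≢0 n₂≢0 ℓ₁≢ℓ₂ _ ℓ₂-undetermined p p' d d≢0 f⊆U g⊆U f≢g d∈ℓ₁ =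
  common-point⇒meet∞ n₁ n₂ d n₁≢0 n₂≢0 ℓ₁≢ℓ₂ d≢0 d∈ℓ₁ d∈ℓ₂
  where
  open AffineSpace K
  d∈ℓ₂ : Geometry.OnLine∞ K d n₂
  d∈ℓ₂ = parallels-on-undetermined-line U not-planar n₂ ℓ₂-undetermined p p' d d≢0 f⊆U g⊆U f≢g
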